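{- Let $G$ be a bridgeless cubic graph having a $2$-factor all of whose cycles are chordless cycles of length $5$. If the multigraph $G^*$ has chromatic index $5$, then $G$ has a Fulkerson covering.
   Context: $G^*$ denotes the multigraph obtained from $G$ by contracting each $5$-cycle of the given $2$-factor to a single vertex (the remaining edges, which form the perfect matching complementary to the $2$-factor, become the edges of $G^*$); $G^*$ is $5$-regular. A Fulkerson covering of $G$ is a family of $6$ perfect matchings of $G$ (not necessarily distinct) such that every edge of $G$ lies in exactly two of them. -}

module Defs where

open import Data.Nat using (ℕ; _<_)
open import Data.Fin using (Fin; _≟_)
open import Data.Bool using (Bool; true; false; _∧_; _∨_; if_then_else_)
open import Data.List using (List; map; allFin)
open import Data.Nat.ListAction using (sum)
open import Data.Product using (Σ; ∃; _×_; proj₁)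
open import Data.Sum using (_⊎_)
open import Relation.Nullary using (¬_; does)
open import Relation.Binary.PropositionalEquality using (_≡_; _≢_)
open import Function.Definitions using (Injective)

record FinGraph : Set where
  field
    n    : ℕ
    m    : ℕ
    end₁ : Fin m → Fin n
    end₂ : Fin m → Fin n

module _ (G : FinGraph) where
  open FinGraph G

  EdgeSet : Set
  EdgeSet = Fin m → Bool

  Loopless : Set
  Loopless = ∀ e → end₁ e ≢ end₂ e

  incᵇ : Fin m → Fin n → Bool
  incᵇ e x = does (end₁ e ≟ x) ∨ does (end₂ e ≟ x)

  -- number of edges of S incident with x (loopless setting)
  degIn : EdgeSet → Fin n → ℕ
  degIn S x = sum (map (λ e → if S e ∧ incᵇ e x then 1 else 0) (allFin m))

  Cubic : Set
  Cubic = ∀ x → degIn (λ _ → true) x ≡ 3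

  data Conn (P : Fin m → Set) : Fin n → Fin n → Set where
    here : ∀ {x} → Conn P x x
    step₁₂ : ∀ {y} f → P f → Conn P (end₂ f) y → Conn P (end₁ f) y
    step₂₁ : ∀ {y} f → P f → Conn P (end₁ f) y → Conn P (end₂ f) y

  Bridgeless : Set
  Bridgeless = ∀ e → Conn (λ f → f ≢ e) (end₁ e) (end₂ e)

  PerfectMatching : EdgeSet → Set
  PerfectMatching M = ∀ x → degIn M x ≡ 1

  TwoFactor : EdgeSet → Set
  TwoFactor F = ∀ x → degIn F x ≡ 2

  SameCycle : EdgeSet → Fin n → Fin n → Set
  SameCycle F = Conn (λ e → F e ≡ true)

  CyclesOfLength5 : EdgeSet → Set
  CyclesOfLength5 F = ∀ x → Σ (Fin 5 → Fin n) λ w →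
    Injective _≡_ _≡_ w ×
    (∀ y → (SameCycle F x y → ∃ λ i → w i ≡ y) × ((∃ λ i → w i ≡ y) → SameCycle F x y))

  CyclesChordless : EdgeSet → Set
  CyclesChordless F = ∀ e → F e ≡ false → ¬ SameCycle F (end₁ e) (end₂ e)

  ChordlessFiveCycleTwoFactor : EdgeSet → Set
  ChordlessFiveCycleTwoFactor F = TwoFactor F × CyclesOfLength5 F × CyclesChordless F

  FulkersonCovering : Set
  FulkersonCovering = Σ (Fin 6 → EdgeSet) λ M →
    (∀ i → PerfectMatching (M i)) ×
    (∀ e → sum (map (λ i → if M i e then 1 else 0) (allFin 6)) ≡ 2)

-- Multigraphs whose vertex set is a setoid (used for quotients/contractions).

record SMultigraph : Set₁ where
  field
    V    : Set
    E    : Set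
    _≈_  : V → V → Set
    end₁ : E → V
    end₂ : E → V

module _ (H : SMultigraph) where
  open SMultigraph H

  Adjacent : E → E → Set
  Adjacent e f = e ≢ f ×
    ((end₁ e ≈ end₁ f) ⊎ (end₁ e ≈ end₂ f) ⊎ (end₂ e ≈ end₁ f) ⊎ (end₂ e ≈ end₂ f))

  EdgeColourable : ℕ → Set
  EdgeColourable k = Σ (E → Fin k) λ c → ∀ e f → Adjacent e f → c e ≢ c f

  HasChromaticIndex : ℕ → Set
  HasChromaticIndex k = EdgeColourable k × (∀ j → j < k → ¬ EdgeColourable j)

-- G* : contract each cycle of the 2-factor F; vertices of G* are the
-- cycles (vertices of G up to SameCycle), edges are the edges not in F.
Contract : (G : FinGraph) → EdgeSet G → SMultigraph
Contract G F = record
  { V    = Fin (FinGraph.n G)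
  ; E    = Σ (Fin (FinGraph.m G)) (λ e → F e ≡ false)
  ; _≈_  = SameCycle G F
  ; end₁ = λ e → FinGraph.end₁ G (proj₁ e)
  ; end₂ = λ e → FinGraph.end₂ G (proj₁ e)
  }

-- Colour the edges of G* properly with five colours and give each vertex of G the colour
-- of its matching edge, its unique edge outside the 2-factor F.  A vertex set closed under
-- F-neighbours is a union of cycles of F and so has at least five elements; hence the walk
-- a′ a x b b′ along F through any vertex x visits five distinct vertices, the whole
-- pentagon of x.  Distinct vertices of one pentagon have distinct matching edges (there are
-- no chords), and these meet in G*, so the five colours on a pentagon are all different.
-- Let M₀ = E ∖ F and, for each colour i, let Mᵢ consist of the matching edges of colour i
-- and of the F-edges uv such that the F-neighbour of u or of v beyond uv has colour i.
-- In a pentagon v₀ … v₄ with v₀ of colour i these are v₁v₂ and v₃v₄, so Mᵢ is a perfect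
-- matching; and the pentagon edge vₖvₖ₊₁ lies exactly in M_c(vₖ₋₁) and M_c(vₖ₊₂), so every
-- edge is covered twice.

module Submission where

open import Defs
open import Data.Nat using (ℕ; zero; suc; _+_; _≤_; _≤?_; s≤s)
import Data.Nat.Properties as ℕ
open import Algebra.Properties.CommutativeSemigroup ℕ.+-commutativeSemigroup using (x∙yz≈y∙xz)
open import Data.Fin using (Fin; zero; suc; _≟_; _<_; punchOut)
open import Data.Fin.Patterns using (0F; 1F; 2F; 3F; 4F)
open import Data.Fin.Properties using (any?; pigeonhole; punchOut-injective; injective⇒≤; <-cmp; <⇒≢)
open import Data.Bool using (Bool; true; false; not; _∧_; _∨_; if_then_else_)
import Data.Bool as Bool
open import Data.Bool.Properties using (∨-zeroʳ; ∨-comm; ∧-identityʳ; ∧-conicalˡ; ∧-conicalʳ; not-injective)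
open import Data.List using (List; []; _∷_; map; allFin; tabulate; length; lookup)
open import Data.Nat.ListAction using (sum)
open import Data.List.Properties using (map-cong-local)
open import Data.List.Membership.Propositional using (_∈_)
open import Data.List.Relation.Unary.Any using (here; there; index)
open import Data.List.Relation.Unary.Any.Properties using (lookup-index)
open import Data.List.Relation.Unary.All as All using (All; []; _∷_)
open import Data.List.Relation.Unary.AllPairs using ([]; _∷_)
open import Data.List.Relation.Unary.Unique.Propositional using (Unique)
open import Data.Product using (∃; ∃₂; _×_; _,_; proj₁; proj₂)
open import Data.Sum using (_⊎_; inj₁; inj₂)
open import Function using (_∘_; id)
open import Function.Definitions using (Injective)
open import Relation.Binary.Definitions using (tri<; tri≈; tri>)
open import Relation.Nullary using (¬_; does; yes; no; contradiction)
open import Relation.Nullary.Decidable using (dec-true; dec-false; from-no)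
open import Relation.Binary.PropositionalEquality
open import Axiom.UniquenessOfIdentityProofs using (module Decidable⇒UIP)

ind : Bool → ℕ
ind b = if b then 1 else 0

_≡ᵇ_ : ∀ {k} → Fin k → Fin k → Bool
i ≡ᵇ j = does (i ≟ j)

≡ᵇ⇒≡ : ∀ {k} {i j : Fin k} → i ≡ᵇ j ≡ true → i ≡ j
≡ᵇ⇒≡ {i = i} {j} h with i ≟ j
... | yes i≡j = i≡j

count : ∀ {k} → (Fin k → Bool) → ℕ
count {zero}  p = 0
count {suc k} p = ind (p zero) + count (p ∘ suc)

sum-allFin : ∀ {k} (p : Fin k → Bool) → sum (map (ind ∘ p) (allFin k)) ≡ count p
sum-allFin {k} p = sum-tabulate id
  where
  sum-tabulate : ∀ {j} (f : Fin j → Fin k) → sum (map (ind ∘ p) (tabulate f)) ≡ count (p ∘ f)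
  sum-tabulate {zero}  f = refl
  sum-tabulate {suc j} f = cong (ind (p (f zero)) +_) (sum-tabulate (f ∘ suc))

count-partition : ∀ {k} (q p : Fin k → Bool) →
  count p ≡ count (λ i → q i ∧ p i) + count (λ i → not (q i) ∧ p i)
count-partition {zero}  q p = refl
count-partition {suc k} q p with q zero | count-partition (q ∘ suc) (p ∘ suc)
... | true  | ih = trans (cong (ind (p zero) +_) ih) (sym (ℕ.+-assoc (ind (p zero)) _ _))
... | false | ih = trans (cong (ind (p zero) +_) ih) (x∙yz≈y∙xz (ind (p zero))
  (count (λ i → q (suc i) ∧ p (suc i))) (count (λ i → not (q (suc i)) ∧ p (suc i))))

count≡0⇒false : ∀ {k} (p : Fin k → Bool) → count p ≡ 0 → ∀ i → p i ≡ false
count≡0⇒false {suc k} p h i with p zero in p₀ | i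
... | false | zero  = p₀
... | false | suc i = count≡0⇒false (p ∘ suc) h i

count-false : ∀ {k} (p : Fin k → Bool) → (∀ i → p i ≡ false) → count p ≡ 0
count-false {zero}  p off = refl
count-false {suc k} p off rewrite off zero = count-false (p ∘ suc) (off ∘ suc)

_∖_ : ∀ {k} → (Fin k → Bool) → Fin k → Fin k → Bool
(p ∖ a) i = not (i ≡ᵇ a) ∧ p i

∖-≢ : ∀ {k} (p : Fin k → Bool) {a i : Fin k} → i ≢ a → (p ∖ a) i ≡ p i
∖-≢ p {a} {i} i≢a rewrite dec-false (i ≟ a) i≢a = refl

∖-true : ∀ {k} (p : Fin k → Bool) {a i : Fin k} → (p ∖ a) i ≡ true → i ≢ a × p i ≡ true
∖-true p {a} {i} h with i ≟ a
... | no i≢a = i≢a , h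

count-remove : ∀ {k} (p : Fin k → Bool) a → count p ≡ ind (p a) + count (p ∖ a)
count-remove p zero    = refl
count-remove p (suc a) =
  trans (cong (ind (p zero) +_) (count-remove (p ∘ suc) a))
        (x∙yz≈y∙xz (ind (p zero)) (ind (p (suc a))) (count ((p ∘ suc) ∖ a)))

count≡suc⇒true : ∀ {k n} (p : Fin k → Bool) → count p ≡ suc n → ∃ λ a → p a ≡ true
count≡suc⇒true {suc k} p h with p zero in p₀
... | true  = zero , p₀
... | false = let a , pa = count≡suc⇒true (p ∘ suc) h in suc a , pa

count≡suc⇒∖ : ∀ {k n} (p : Fin k → Bool) → count p ≡ suc n →
  ∃ λ a → p a ≡ true × count (p ∖ a) ≡ n
count≡suc⇒∖ p h with a , pa ← count≡suc⇒true p h =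
  a , pa , ℕ.suc-injective (begin
    ind true + count (p ∖ a)  ≡⟨ cong (λ b → ind b + count (p ∖ a)) pa ⟨
    ind (p a) + count (p ∖ a) ≡⟨ count-remove p a ⟨
    count p                   ≡⟨ h ⟩
    suc _                     ∎)
  where open ≡-Reasoning

count-∖≡0⇒≡ : ∀ {k} (p : Fin k → Bool) {a} → count (p ∖ a) ≡ 0 → ∀ {i} → p i ≡ true → i ≡ a
count-∖≡0⇒≡ p {a} h {i} pi with i ≟ a
... | yes i≡a = i≡a
... | no  i≢a with () ← trans (sym pi) (trans (sym (∖-≢ p i≢a)) (count≡0⇒false (p ∖ a) h i))

count≡1⇒unique : ∀ {k} (p : Fin k → Bool) → count p ≡ 1 →
  ∃ λ a → p a ≡ true × ∀ {i} → p i ≡ true → i ≡ a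
count≡1⇒unique p h with a , pa , rest ← count≡suc⇒∖ p h = a , pa , count-∖≡0⇒≡ p rest

count≡2⇒pair : ∀ {k} (p : Fin k → Bool) → count p ≡ 2 →
  ∃₂ λ a b → a ≢ b × p a ≡ true × p b ≡ true × ∀ {i} → p i ≡ true → i ≡ a ⊎ i ≡ b
count≡2⇒pair p h with a , pa , rest ← count≡suc⇒∖ p h
                 with b , pb , only-b ← count≡1⇒unique (p ∖ a) rest
  = a , b , (λ a≡b → proj₁ (∖-true p pb) (sym a≡b)) , pa , proj₂ (∖-true p pb) , classify
  where
  classify : ∀ {i} → p i ≡ true → i ≡ a ⊎ i ≡ b
  classify {i} pi with i ≟ a
  ... | yes i≡a = inj₁ i≡a
  ... | no  i≢a = inj₂ (only-b (trans (∖-≢ p i≢a) pi))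

count-support : ∀ {k} (p : Fin k → Bool) (xs : List (Fin k)) → Unique xs →
  (∀ {i} → p i ≡ true → i ∈ xs) → count p ≡ sum (map (ind ∘ p) xs)
count-support p []       _               supp = count-false p off
  where
  off : ∀ i → p i ≡ false
  off i with p i in pi
  ... | true  with () ← supp pi
  ... | false = refl
count-support p (a ∷ xs) (a∉xs ∷ uniq) supp = begin
  count p                              ≡⟨ count-remove p a ⟩
  ind (p a) + count (p ∖ a)                ≡⟨ cong (ind (p a) +_) (count-support (p ∖ a) xs uniq supp′) ⟩
  ind (p a) + sum (map (ind ∘ (p ∖ a)) xs) ≡⟨ cong (λ ys → ind (p a) + sum ys) (map-cong-local agrees) ⟩
  ind (p a) + sum (map (ind ∘ p) xs)       ∎
  where
  open ≡-Reasoning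
  agrees : All (λ i → ind ((p ∖ a) i) ≡ ind (p i)) xs
  agrees = All.map (λ a≢i → cong ind (∖-≢ p (a≢i ∘ sym))) a∉xs
  supp′ : ∀ {i} → (p ∖ a) i ≡ true → i ∈ xs
  supp′ h with i≢a , pi ← ∖-true p h with supp pi
  ... | here i≡a  = contradiction i≡a i≢a
  ... | there i∈xs = i∈xs

count-≡ᵇ : ∀ {k} (c : Fin k) → count (c ≡ᵇ_) ≡ 1
count-≡ᵇ c rewrite count-support (c ≡ᵇ_) (c ∷ []) ([] ∷ []) (λ h → here (sym (≡ᵇ⇒≡ h)))
                 | dec-true (c ≟ c) refl = refl

count-≡ᵇ-pair : ∀ {k} {c d : Fin k} → c ≢ d → count (λ i → c ≡ᵇ i ∨ d ≡ᵇ i) ≡ 2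
count-≡ᵇ-pair {c = c} {d} c≢d =
  trans (count-support (λ i → c ≡ᵇ i ∨ d ≡ᵇ i) (c ∷ d ∷ []) ((c≢d ∷ []) ∷ [] ∷ []) supported) sum≡2
  where
  supported : ∀ {i} → c ≡ᵇ i ∨ d ≡ᵇ i ≡ true → i ∈ c ∷ d ∷ []
  supported {i} h with c ≟ i
  ... | yes c≡i = here (sym c≡i)
  ... | no  _   = there (here (sym (≡ᵇ⇒≡ h)))
  sum≡2 : sum (map (λ i → ind (c ≡ᵇ i ∨ d ≡ᵇ i)) (c ∷ d ∷ [])) ≡ 2
  sum≡2 rewrite dec-true (c ≟ c) refl | dec-false (c ≟ d) c≢d | dec-true (d ≟ d) refl = refl

injective⇒surjective : ∀ {k} (c : Fin k → Fin k) → Injective _≡_ _≡_ c → ∀ i → ∃ λ j → c j ≡ i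
injective⇒surjective {suc k} c c-inj i with any? (λ j → c j ≟ i)
... | yes hit  = hit
... | no  miss
  with j , j′ , j<j′ , same ← pigeonhole (ℕ.n<1+n k) (λ j → punchOut {j = c j} (miss ∘ (j ,_) ∘ sym))
  = contradiction (c-inj (punchOut-injective (miss ∘ (j ,_) ∘ sym) (miss ∘ (j′ ,_) ∘ sym) same))
                  (<⇒≢ j<j′)

sum-one-hot : (b : Fin 5 → Bool) (j : Fin 5) → b j ≡ true → (∀ k → k ≢ j → b k ≡ false) →
  sum (map ind (b 0F ∷ (b 4F ∨ b 2F) ∷ (b 1F ∨ b 3F) ∷ [])) ≡ 1
sum-one-hot b 0F hit miss rewrite hit | miss 1F (λ ()) | miss 2F (λ ()) | miss 3F (λ ()) | miss 4F (λ ()) = refl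
sum-one-hot b 1F hit miss rewrite hit | miss 0F (λ ()) | miss 2F (λ ()) | miss 4F (λ ()) = refl
sum-one-hot b 2F hit miss rewrite hit | miss 0F (λ ()) | miss 1F (λ ()) | miss 3F (λ ()) | miss 4F (λ ()) = refl
sum-one-hot b 3F hit miss rewrite hit | miss 0F (λ ()) | miss 1F (λ ()) | miss 2F (λ ()) | miss 4F (λ ()) = refl
sum-one-hot b 4F hit miss rewrite hit | miss 0F (λ ()) | miss 1F (λ ()) | miss 3F (λ ()) = refl

-- The entries are the memberships in Mᵢ of the three edges at corner 0 of a pentagon
-- coloured by c: its matching edge and the pentagon edges to corners 1 and 4.
pentagon-sum : (c : Fin 5 → Fin 5) → Injective _≡_ _≡_ c → ∀ i →
  sum (map ind (c 0F ≡ᵇ i ∷ (c 4F ≡ᵇ i ∨ c 2F ≡ᵇ i) ∷ (c 1F ≡ᵇ i ∨ c 3F ≡ᵇ i) ∷ [])) ≡ 1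
pentagon-sum c c-inj i with j , cj≡i ← injective⇒surjective c c-inj i =
  sum-one-hot (λ k → c k ≡ᵇ i) j (dec-true (c j ≟ i) cj≡i)
    (λ k k≢j → dec-false (c k ≟ i) (λ ck≡i → k≢j (c-inj (trans ck≡i (sym cj≡i)))))

module Incidence (G : FinGraph) (loopless : Loopless G) where
  open FinGraph G

  infix 4 _∋_
  _∋_ : Fin m → Fin n → Set
  e ∋ u = incᵇ G e u ≡ true

  ∋-end₁ : ∀ e → e ∋ end₁ e
  ∋-end₁ e rewrite dec-true (end₁ e ≟ end₁ e) refl = refl

  ∋-end₂ : ∀ e → e ∋ end₂ e
  ∋-end₂ e rewrite dec-true (end₂ e ≟ end₂ e) refl = ∨-zeroʳ _

  ∋⇒end : ∀ {e u} → e ∋ u → end₁ e ≡ u ⊎ end₂ e ≡ u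
  ∋⇒end {e} {u} h with end₁ e ≟ u | end₂ e ≟ u
  ... | yes e₁≡u | _        = inj₁ e₁≡u
  ... | no _     | yes e₂≡u = inj₂ e₂≡u

  other : Fin m → Fin n → Fin n
  other e u = if end₁ e ≡ᵇ u then end₂ e else end₁ e

  other-end₁ : ∀ e → other e (end₁ e) ≡ end₂ e
  other-end₁ e rewrite dec-true (end₁ e ≟ end₁ e) refl = refl

  other-end₂ : ∀ e → other e (end₂ e) ≡ end₁ e
  other-end₂ e rewrite dec-false (end₁ e ≟ end₂ e) (loopless e) = refl

  ∋-other : ∀ {e u} → e ∋ u → e ∋ other e u
  ∋-other {e} h with ∋⇒end h
  ... | inj₁ refl rewrite other-end₁ e = ∋-end₂ e
  ... | inj₂ refl rewrite other-end₂ e = ∋-end₁ e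

  other-≢ : ∀ {e u} → e ∋ u → other e u ≢ u
  other-≢ {e} h with ∋⇒end h
  ... | inj₁ refl rewrite other-end₁ e = loopless e ∘ sym
  ... | inj₂ refl rewrite other-end₂ e = loopless e

  other-involutive : ∀ {e u} → e ∋ u → other e (other e u) ≡ u
  other-involutive {e} h with ∋⇒end h
  ... | inj₁ refl rewrite other-end₁ e = other-end₂ e
  ... | inj₂ refl rewrite other-end₂ e = other-end₁ e

  ∋⇒≡other : ∀ {e u v} → e ∋ u → e ∋ v → v ≢ u → v ≡ other e u
  ∋⇒≡other {e} hu hv v≢u with ∋⇒end hu | ∋⇒end hv
  ... | inj₁ refl | inj₁ refl = contradiction refl v≢u
  ... | inj₁ refl | inj₂ refl = sym (other-end₁ e)
  ... | inj₂ refl | inj₁ refl = sym (other-end₂ e)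
  ... | inj₂ refl | inj₂ refl = contradiction refl v≢u

  ends-related : ∀ {R : Fin n → Fin n → Set} {e f u v} → e ∋ u → f ∋ v → R u v →
    R (end₁ e) (end₁ f) ⊎ R (end₁ e) (end₂ f) ⊎ R (end₂ e) (end₁ f) ⊎ R (end₂ e) (end₂ f)
  ends-related e∋u f∋v r with ∋⇒end e∋u | ∋⇒end f∋v
  ... | inj₁ refl | inj₁ refl = inj₁ r
  ... | inj₁ refl | inj₂ refl = inj₂ (inj₁ r)
  ... | inj₂ refl | inj₁ refl = inj₂ (inj₂ (inj₁ r))
  ... | inj₂ refl | inj₂ refl = inj₂ (inj₂ (inj₂ r))

  module _ {P : Fin m → Set} where

    Conn-trans : ∀ {u v w} → Conn G P u v → Conn G P v w → Conn G P u w
    Conn-trans here             c = c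
    Conn-trans (step₁₂ f pf c′) c = step₁₂ f pf (Conn-trans c′ c)
    Conn-trans (step₂₁ f pf c′) c = step₂₁ f pf (Conn-trans c′ c)

    Conn-sym : ∀ {u v} → Conn G P u v → Conn G P v u
    Conn-sym here             = here
    Conn-sym (step₁₂ f pf c) = Conn-trans (Conn-sym c) (step₂₁ f pf here)
    Conn-sym (step₂₁ f pf c) = Conn-trans (Conn-sym c) (step₁₂ f pf here)

    Conn-edge : ∀ {e u} → P e → e ∋ u → Conn G P u (other e u)
    Conn-edge {e} pe h with ∋⇒end h
    ... | inj₁ refl rewrite other-end₁ e = step₁₂ e pe here
    ... | inj₂ refl rewrite other-end₂ e = step₂₁ e pe here

module TwoFactorStructure (G : FinGraph) (loopless : Loopless G) (cubic : Cubic G)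
  (F : EdgeSet G) (twoFactor : TwoFactor G F) where
  open FinGraph G
  open Incidence G loopless

  degIn≡count : ∀ (S : EdgeSet G) x → degIn G S x ≡ count (λ e → S e ∧ incᵇ G e x)
  degIn≡count S x = sum-allFin (λ e → S e ∧ incᵇ G e x)

  F-degree : ∀ x → count (λ e → F e ∧ incᵇ G e x) ≡ 2
  F-degree x = trans (sym (degIn≡count F x)) (twoFactor x)

  non-F-degree : ∀ x → count (λ e → not (F e) ∧ incᵇ G e x) ≡ 1
  non-F-degree x = ℕ.+-cancelˡ-≡ 2 _ _ (begin
    2 + count (λ e → not (F e) ∧ incᵇ G e x)
      ≡⟨ cong (_+ count (λ e → not (F e) ∧ incᵇ G e x)) (F-degree x) ⟨
    count (λ e → F e ∧ incᵇ G e x) + count (λ e → not (F e) ∧ incᵇ G e x)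
      ≡⟨ count-partition F (λ e → incᵇ G e x) ⟨
    count (λ e → incᵇ G e x)
      ≡⟨ trans (sym (degIn≡count (λ _ → true) x)) (cubic x) ⟩
    3 ∎)
    where open ≡-Reasoning

  ∉F-∈F-≢ : ∀ {e f} → F e ≡ false → F f ≡ true → e ≢ f
  ∉F-∈F-≢ e∉F f∈F refl = contradiction (trans (sym e∉F) f∈F) λ ()

  record Fork (u : Fin n) : Set where
    constructor fork
    field
      p q : Fin m
      p∈F : F p ≡ true
      q∈F : F q ≡ true
      p∋u : p ∋ u
      q∋u : q ∋ u
      p≢q : p ≢ q

  swap : ∀ {u} → Fork u → Fork u
  swap (fork p q p∈F q∈F p∋u q∋u p≢q) = fork q p q∈F p∈F q∋u p∋u (p≢q ∘ sym)

  record Star (x : Fin n) : Set where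
    field
      g : Fin m
      g∉F : F g ≡ false
      g∋x : g ∋ x
      only-g : ∀ {f} → F f ≡ false → f ∋ x → f ≡ g
      F-fork : Fork x
      only-F-fork : ∀ {f} → F f ≡ true → f ∋ x → f ≡ Fork.p F-fork ⊎ f ≡ Fork.q F-fork

  opaque
    star : ∀ x → Star x
    star x
      with e₁ , e₂ , e₁≢e₂ , e₁∈ , e₂∈ , only-e ← count≡2⇒pair _ (F-degree x)
      with g , g∈ , only-g ← count≡1⇒unique _ (non-F-degree x)
      = record
        { g           = g
        ; g∉F         = not-injective (∧-conicalˡ _ _ g∈)
        ; g∋x         = ∧-conicalʳ _ _ g∈
        ; only-g      = λ f∉F f∋x → only-g (cong₂ _∧_ (cong not f∉F) f∋x)
        ; F-fork      = fork e₁ e₂ (∧-conicalˡ _ _ e₁∈) (∧-conicalˡ _ _ e₂∈)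
                             (∧-conicalʳ _ _ e₁∈) (∧-conicalʳ _ _ e₂∈) e₁≢e₂
        ; only-F-fork = λ f∈F f∋x → only-e (cong₂ _∧_ f∈F f∋x)
        }

  F-edge-pair : ∀ {u f} (φ : Fork u) → F f ≡ true → f ∋ u → f ≡ Fork.p φ ⊎ f ≡ Fork.q φ
  F-edge-pair {u} (fork p q p∈F q∈F p∋u q∋u p≢q) f∈F f∋u
    with only-F-fork p∈F p∋u | only-F-fork q∈F q∋u | only-F-fork f∈F f∋u
    where open Star (star u)
  ... | inj₁ refl | inj₁ refl | _         = contradiction refl p≢q
  ... | inj₂ refl | inj₂ refl | _         = contradiction refl p≢q
  ... | inj₁ refl | inj₂ refl | f≡        = f≡
  ... | inj₂ refl | inj₁ refl | inj₁ f≡q = inj₂ f≡q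
  ... | inj₂ refl | inj₁ refl | inj₂ f≡p = inj₁ f≡p

  otherF : Fin n → Fin m → Fin m
  otherF u e = if e ≡ᵇ p then q else p
    where open Fork (Star.F-fork (star u))

  otherF-∈F : ∀ u e → F (otherF u e) ≡ true
  otherF-∈F u e with e ≟ Fork.p (Star.F-fork (star u))
  ... | yes _ = Fork.q∈F (Star.F-fork (star u))
  ... | no  _ = Fork.p∈F (Star.F-fork (star u))

  otherF-∋ : ∀ u e → otherF u e ∋ u
  otherF-∋ u e with e ≟ Fork.p (Star.F-fork (star u))
  ... | yes _ = Fork.q∋u (Star.F-fork (star u))
  ... | no  _ = Fork.p∋u (Star.F-fork (star u))

  otherF-≢ : ∀ u e → otherF u e ≢ e
  otherF-≢ u e with e ≟ Fork.p (Star.F-fork (star u))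
  ... | yes refl = Fork.p≢q (Star.F-fork (star u)) ∘ sym
  ... | no  e≢p  = e≢p ∘ sym

  forkAt : ∀ {u e} → F e ≡ true → e ∋ u → Fork u
  forkAt {u} {e} e∈F e∋u =
    fork e (otherF u e) e∈F (otherF-∈F u e) e∋u (otherF-∋ u e) (otherF-≢ u e ∘ sym)

  otherF-fork : ∀ {u} (φ : Fork u) → otherF u (Fork.p φ) ≡ Fork.q φ
  otherF-fork {u} φ with F-edge-pair φ (otherF-∈F u p) (otherF-∋ u p)
    where open Fork φ
  ... | inj₁ otherF≡p = contradiction otherF≡p (otherF-≢ u (Fork.p φ))
  ... | inj₂ otherF≡q = otherF≡q

  beyond : Fin n → Fin m → Fin n
  beyond u e = other (otherF u e) u

  degIn-fork : ∀ (S : EdgeSet G) {x} (φ : Fork x) →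
    degIn G S x ≡ sum (map (ind ∘ S) (Star.g (star x) ∷ Fork.p φ ∷ Fork.q φ ∷ []))
  degIn-fork S {x} φ = begin
    degIn G S x                                           ≡⟨ degIn≡count S x ⟩
    count (λ e → S e ∧ incᵇ G e x)                        ≡⟨ count-support _ edges distinct supported ⟩
    sum (map (λ e → ind (S e ∧ incᵇ G e x)) edges)        ≡⟨ cong sum (map-cong-local {xs = edges} incident) ⟩
    sum (map (ind ∘ S) edges)                             ∎
    where
    open ≡-Reasoning
    open Star (star x) using (g; g∉F; g∋x; only-g)
    open Fork φ
    edges : List (Fin m)
    edges = g ∷ p ∷ q ∷ []
    distinct : Unique edges
    distinct = (∉F-∈F-≢ g∉F p∈F ∷ ∉F-∈F-≢ g∉F q∈F ∷ []) ∷ (p≢q ∷ []) ∷ [] ∷ []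
    supported : ∀ {e} → S e ∧ incᵇ G e x ≡ true → e ∈ edges
    supported {e} h with F e in e∈F? | ∧-conicalʳ (S e) _ h
    ... | false | e∋x = here (only-g e∈F? e∋x)
    ... | true  | e∋x with F-edge-pair φ e∈F? e∋x
    ...   | inj₁ e≡p = there (here e≡p)
    ...   | inj₂ e≡q = there (there (here e≡q))
    at : ∀ {e} → e ∋ x → ind (S e ∧ incᵇ G e x) ≡ ind (S e)
    at {e} e∋x rewrite e∋x = cong ind (∧-identityʳ (S e))
    incident : All (λ e → ind (S e ∧ incᵇ G e x) ≡ ind (S e)) edges
    incident = at g∋x ∷ at p∋u ∷ at q∋u ∷ []

  complement-perfect : PerfectMatching G (not ∘ F)
  complement-perfect x = trans (degIn-fork (not ∘ F) F-fork) (cong (sum ∘ map (ind ∘ not)) edges∈F)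
    where
    open Star (star x)
    open Fork F-fork
    edges∈F : F g ∷ F p ∷ F q ∷ [] ≡ false ∷ true ∷ true ∷ []
    edges∈F = cong₂ _∷_ g∉F (cong₂ _∷_ p∈F (cong₂ _∷_ q∈F refl))

module FiveCycles (G : FinGraph) (loopless : Loopless G) (cubic : Cubic G)
  (F : EdgeSet G) (twoFactor : TwoFactor G F) (fiveCycles : CyclesOfLength5 G F) where
  open FinGraph G
  open Incidence G loopless
  open TwoFactorStructure G loopless cubic F twoFactor

  Closed : List (Fin n) → Set
  Closed vs = ∀ {u e} → u ∈ vs → F e ≡ true → e ∋ u → other e u ∈ vs

  closed-reach : ∀ {vs u v} → Closed vs → SameCycle G F u v → u ∈ vs → v ∈ vs
  closed-reach closed here             u∈ = u∈
  closed-reach closed (step₁₂ f f∈F c) u∈ =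
    closed-reach closed c (subst (_∈ _) (other-end₁ f) (closed u∈ f∈F (∋-end₁ f)))
  closed-reach closed (step₂₁ f f∈F c) u∈ =
    closed-reach closed c (subst (_∈ _) (other-end₂ f) (closed u∈ f∈F (∋-end₂ f)))

  closed⇒5≤length : ∀ {vs u} → Closed vs → u ∈ vs → 5 ≤ length vs
  closed⇒5≤length {vs} {u} closed u∈ = injective⇒≤ {f = index ∘ w∈} λ {i} {j} same →
    w-injective (begin
      w i                        ≡⟨ lookup-index (w∈ i) ⟩
      lookup vs (index (w∈ i))   ≡⟨ cong (lookup vs) same ⟩
      lookup vs (index (w∈ j))   ≡⟨ lookup-index (w∈ j) ⟨
      w j                        ∎)
    where
    open ≡-Reasoning
    w : Fin 5 → Fin n
    w = proj₁ (fiveCycles u)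
    w-injective : Injective _≡_ _≡_ w
    w-injective = proj₁ (proj₂ (fiveCycles u))
    w∈ : ∀ i → w i ∈ vs
    w∈ i = closed-reach closed (proj₂ (proj₂ (proj₂ (fiveCycles u)) (w i)) (i , refl)) u∈

  closed-at : ∀ {vs u} (φ : Fork u) → other (Fork.p φ) u ∈ vs → other (Fork.q φ) u ∈ vs →
    ∀ {e} → F e ≡ true → e ∋ u → other e u ∈ vs
  closed-at φ p-in q-in e∈F e∋u with F-edge-pair φ e∈F e∋u
  ... | inj₁ refl = p-in
  ... | inj₂ refl = q-in

  module Side {x : Fin n} (φ : Fork x) where
    open Fork φ

    a b : Fin n
    a = other p x
    b = other q x

    p′ q′ : Fin m
    p′ = otherF a p
    q′ = otherF b q

    a′ b′ : Fin n
    a′ = other p′ a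
    b′ = other q′ b

    p∋a : p ∋ a
    p∋a = ∋-other p∋u

    q∋b : q ∋ b
    q∋b = ∋-other q∋u

    p′∋a : p′ ∋ a
    p′∋a = otherF-∋ a p

    q′∋b : q′ ∋ b
    q′∋b = otherF-∋ b q

    a≢x : a ≢ x
    a≢x = other-≢ p∋u

    a′≢a : a′ ≢ a
    a′≢a = other-≢ p′∋a

    a-sameCycle : SameCycle G F x a
    a-sameCycle = Conn-edge p∈F p∋u

    a′-sameCycle : SameCycle G F x a′
    a′-sameCycle = Conn-trans a-sameCycle (Conn-edge (otherF-∈F a p) p′∋a)

    a≢b : a ≢ b
    a≢b a≡b = contradiction (closed⇒5≤length closed (here refl)) (from-no (5 ≤? 2))
      where
      q∋a : q ∋ a
      q∋a = subst (q ∋_) (sym a≡b) q∋b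
      closed : Closed (x ∷ a ∷ [])
      closed (here refl)         = closed-at φ (there (here refl)) (there (here (sym a≡b)))
      closed (there (here refl)) = closed-at (fork p q p∈F q∈F p∋a q∋a p≢q)
        (here (other-involutive p∋u)) (here (trans (cong (other q) a≡b) (other-involutive q∋u)))

    a′≢x : a′ ≢ x
    a′≢x a′≡x with F-edge-pair φ (otherF-∈F a p) (subst (p′ ∋_) a′≡x (∋-other p′∋a))
    ... | inj₁ p′≡p = otherF-≢ a p p′≡p
    ... | inj₂ p′≡q = a≢b (∋⇒≡other q∋u (subst (_∋ a) p′≡q p′∋a) a≢x)

    a≢b′ : a ≢ b′
    a≢b′ a≡b′ = contradiction (closed⇒5≤length closed (here refl)) (from-no (5 ≤? 3))
      where
      q′∋a : q′ ∋ a
      q′∋a = subst (q′ ∋_) (sym a≡b′) (∋-other q′∋b)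
      p≢q′ : p ≢ q′
      p≢q′ p≡q′ = a≢b (sym (∋⇒≡other p∋u (subst (_∋ b) (sym p≡q′) q′∋b) (other-≢ q∋u)))
      closed : Closed (x ∷ a ∷ b ∷ [])
      closed (here refl)                 =
        closed-at φ (there (here refl)) (there (there (here refl)))
      closed (there (here refl))         =
        closed-at (fork p q′ p∈F (otherF-∈F b q) p∋a q′∋a p≢q′)
          (here (other-involutive p∋u))
          (there (there (here (sym (∋⇒≡other q′∋a q′∋b (a≢b ∘ sym))))))
      closed (there (there (here refl))) =
        closed-at (forkAt q∈F q∋b) (here (other-involutive q∋u)) (there (here (sym a≡b′)))

  module Pentagon {x : Fin n} (φ : Fork x) where
    open Fork φ
    open Side φ
    -- The mirrored side: S.a, S.a′ are b, b′ and S.b, S.b′ are a, a′.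
    private module S = Side (swap φ)

    a′≢b′ : a′ ≢ b′
    a′≢b′ a′≡b′ = contradiction (closed⇒5≤length closed (here refl)) (from-no (5 ≤? 4))
      where
      q′∋a′ : q′ ∋ a′
      q′∋a′ = subst (q′ ∋_) (sym a′≡b′) (∋-other q′∋b)
      p′≢q′ : p′ ≢ q′
      p′≢q′ p′≡q′ = S.a≢b′ (∋⇒≡other p′∋a (subst (_∋ b) (sym p′≡q′) q′∋b) (a≢b ∘ sym))
      closed : Closed (x ∷ a ∷ b ∷ a′ ∷ [])
      closed (here refl)                         =
        closed-at φ (there (here refl)) (there (there (here refl)))
      closed (there (here refl))                 =
        closed-at (forkAt p∈F p∋a) (here (other-involutive p∋u)) (there (there (there (here refl))))
      closed (there (there (here refl)))         =
        closed-at (forkAt q∈F q∋b)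
          (here (other-involutive q∋u)) (there (there (there (here (sym a′≡b′)))))
      closed (there (there (there (here refl)))) =
        closed-at (fork p′ q′ (otherF-∈F a p) (otherF-∈F b q) (∋-other p′∋a) q′∋a′ p′≢q′)
          (there (here (other-involutive p′∋a)))
          (there (there (here (sym (∋⇒≡other q′∋a′ q′∋b S.a≢b′)))))

    corner : Fin 5 → Fin n
    corner 0F = x
    corner 1F = a
    corner 2F = a′
    corner 3F = b′
    corner 4F = b

    corners-distinct : ∀ {i j} → i < j → corner i ≢ corner j
    corners-distinct {0F} {1F} _ = a≢x ∘ sym
    corners-distinct {0F} {2F} _ = a′≢x ∘ sym
    corners-distinct {0F} {3F} _ = S.a′≢x ∘ sym
    corners-distinct {0F} {4F} _ = S.a≢x ∘ sym
    corners-distinct {1F} {2F} _ = a′≢a ∘ sym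
    corners-distinct {1F} {3F} _ = a≢b′
    corners-distinct {1F} {4F} _ = a≢b
    corners-distinct {2F} {3F} _ = a′≢b′
    corners-distinct {2F} {4F} _ = S.a≢b′ ∘ sym
    corners-distinct {3F} {4F} _ = S.a′≢a
    corners-distinct {_}             {0F} ()
    corners-distinct {suc _}         {1F} (s≤s ())
    corners-distinct {suc (suc _)}   {2F} (s≤s (s≤s ()))
    corners-distinct {suc (suc (suc _))} {3F} (s≤s (s≤s (s≤s ())))
    corners-distinct {4F}            {4F} (s≤s (s≤s (s≤s (s≤s ()))))

    corner-injective : Injective _≡_ _≡_ corner
    corner-injective {i} {j} same with <-cmp i j
    ... | tri< i<j _ _ = contradiction same (corners-distinct i<j)
    ... | tri≈ _ i≡j _ = i≡j
    ... | tri> _ _ j<i = contradiction (sym same) (corners-distinct j<i)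

    corner-sameCycle : ∀ k → SameCycle G F x (corner k)
    corner-sameCycle 0F = here
    corner-sameCycle 1F = a-sameCycle
    corner-sameCycle 2F = a′-sameCycle
    corner-sameCycle 3F = S.a′-sameCycle
    corner-sameCycle 4F = S.a-sameCycle

module Covering (G : FinGraph) (loopless : Loopless G) (cubic : Cubic G)
  (F : EdgeSet G) (twoFactor : TwoFactor G F) (fiveCycles : CyclesOfLength5 G F)
  (chordless : CyclesChordless G F) (col : SMultigraph.E (Contract G F) → Fin 5)
  (proper : ∀ e f → Adjacent (Contract G F) e f → col e ≢ col f) where
  open FinGraph G
  open Incidence G loopless
  open TwoFactorStructure G loopless cubic F twoFactor
  open FiveCycles G loopless cubic F twoFactor fiveCycles
  open Decidable⇒UIP Bool._≟_ using (≡-irrelevant)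

  colour : Fin n → Fin 5
  colour x = col (g , g∉F)
    where open Star (star x)

  colour-matched : ∀ {e x} (e∉F : F e ≡ false) → e ∋ x → colour x ≡ col (e , e∉F)
  colour-matched {e} {x} e∉F e∋x with refl ← Star.only-g (star x) e∉F e∋x =
    cong (λ e∉F′ → col (e , e∉F′)) (≡-irrelevant _ _)

  no-chord : ∀ {e x y} → F e ≡ false → e ∋ x → e ∋ y → x ≢ y → ¬ SameCycle G F x y
  no-chord {e} e∉F e∋x e∋y x≢y c with ∋⇒end e∋x | ∋⇒end e∋y
  ... | inj₁ refl | inj₁ refl = x≢y refl
  ... | inj₁ refl | inj₂ refl = chordless e e∉F c
  ... | inj₂ refl | inj₁ refl = chordless e e∉F (Conn-sym c)
  ... | inj₂ refl | inj₂ refl = x≢y refl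

  colour-≢ : ∀ {x y} → x ≢ y → SameCycle G F x y → colour x ≢ colour y
  colour-≢ {x} {y} x≢y c =
    proper (gx , gx∉F) (gy , gy∉F) (distinct , ends-related {R = SameCycle G F} gx∋x gy∋y c)
    where
    open Star (star x) using () renaming (g to gx; g∉F to gx∉F; g∋x to gx∋x)
    open Star (star y) using () renaming (g to gy; g∉F to gy∉F; g∋x to gy∋y)
    distinct : (gx , gx∉F) ≢ (gy , gy∉F)
    distinct same = no-chord gx∉F gx∋x (subst (_∋ y) (cong proj₁ (sym same)) gy∋y) x≢y c

  pentagon-colour-injective : ∀ {x} (φ : Fork x) → Injective _≡_ _≡_ (colour ∘ Pentagon.corner φ)
  pentagon-colour-injective φ {i} {j} same with i ≟ j
  ... | yes i≡j = i≡j
  ... | no  i≢j = contradiction same (colour-≢ (i≢j ∘ corner-injective)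
                    (Conn-trans (Conn-sym (corner-sameCycle i)) (corner-sameCycle j)))
    where open Pentagon φ

  beyond-colours-≢ : ∀ {e u} → F e ≡ true → e ∋ u →
    colour (beyond u e) ≢ colour (beyond (other e u) e)
  beyond-colours-≢ e∈F e∋u same =
    contradiction (pentagon-colour-injective (forkAt e∈F e∋u) {4F} {2F} same) λ ()

  matchingOf : Fin 5 → EdgeSet G
  matchingOf i e =
    if F e then colour (beyond (end₁ e) e) ≡ᵇ i ∨ colour (beyond (end₂ e) e) ≡ᵇ i
           else colour (end₁ e) ≡ᵇ i

  matchingOf-∉F : ∀ {e x} i → F e ≡ false → e ∋ x → matchingOf i e ≡ colour x ≡ᵇ i
  matchingOf-∉F {e} i e∉F e∋x rewrite e∉F =
    cong (_≡ᵇ i) (trans (colour-matched e∉F (∋-end₁ e)) (sym (colour-matched e∉F e∋x)))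

  matchingOf-∈F : ∀ {e u} i → F e ≡ true → e ∋ u →
    matchingOf i e ≡ (colour (beyond u e) ≡ᵇ i ∨ colour (beyond (other e u) e) ≡ᵇ i)
  matchingOf-∈F {e} i e∈F e∋u with ∋⇒end e∋u
  ... | inj₁ refl rewrite e∈F | other-end₁ e = refl
  ... | inj₂ refl rewrite e∈F | other-end₂ e =
    ∨-comm (colour (beyond (end₁ e) e) ≡ᵇ i) (colour (beyond (end₂ e) e) ≡ᵇ i)

  matchingOf-perfect : ∀ i → PerfectMatching G (matchingOf i)
  matchingOf-perfect i x = begin
    degIn G (matchingOf i) x
      ≡⟨ degIn-fork (matchingOf i) φ ⟩
    sum (map ind (matchingOf i g ∷ matchingOf i p ∷ matchingOf i q ∷ []))
      ≡⟨ cong (sum ∘ map ind) memberships ⟩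
    sum (map ind (c 0F ∷ (c 4F ∨ c 2F) ∷ (c 1F ∨ c 3F) ∷ []))
      ≡⟨ pentagon-sum (colour ∘ corner) (pentagon-colour-injective φ) i ⟩
    1 ∎
    where
    open ≡-Reasoning
    open Star (star x)
    φ : Fork x
    φ = forkAt (Fork.p∈F F-fork) (Fork.p∋u F-fork)
    open Fork φ
    open Pentagon φ
    c : Fin 5 → Bool
    c k = colour (corner k) ≡ᵇ i
    q-membership : matchingOf i q ≡ (c 1F ∨ c 3F)
    q-membership = trans (matchingOf-∈F i q∈F q∋u)
                         (cong (λ e → colour (other e x) ≡ᵇ i ∨ c 3F) (otherF-fork (swap φ)))
    memberships : matchingOf i g ∷ matchingOf i p ∷ matchingOf i q ∷ []
                ≡ c 0F ∷ (c 4F ∨ c 2F) ∷ (c 1F ∨ c 3F) ∷ []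
    memberships = cong₂ _∷_ (matchingOf-∉F i g∉F g∋x)
                 (cong₂ _∷_ (matchingOf-∈F i p∈F p∋u) (cong₂ _∷_ q-membership refl))

  M : Fin 6 → EdgeSet G
  M zero    = not ∘ F
  M (suc i) = matchingOf i

  M-perfect : ∀ j → PerfectMatching G (M j)
  M-perfect zero    = complement-perfect
  M-perfect (suc i) = matchingOf-perfect i

  M-multiplicity : ∀ e → count (λ j → M j e) ≡ 2
  M-multiplicity e with F e in Fe
  ... | false = cong suc (count-≡ᵇ (colour (end₁ e)))
  ... | true  = count-≡ᵇ-pair (subst (λ v → colour (beyond (end₁ e) e) ≢ colour (beyond v e))
                                     (other-end₁ e) (beyond-colours-≢ Fe (∋-end₁ e)))

  fulkerson : FulkersonCovering G
  fulkerson = M , M-perfect , λ e → trans (sum-allFin (λ j → M j e)) (M-multiplicity e)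

theorem5p1 : (G : FinGraph) → Loopless G → Cubic G → Bridgeless G →
    (F : EdgeSet G) → ChordlessFiveCycleTwoFactor G F →
    HasChromaticIndex (Contract G F) 5 →
    FulkersonCovering G
-- Neither bridgelessness nor the lower bound on the chromatic index of G* is needed.
theorem5p1 G loopless cubic _ F (twoFactor , fiveCycles , chordless) ((col , proper) , _) =
  Covering.fulkerson G loopless cubic F twoFactor fiveCycles chordless col proper
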